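{- The following two statements are equivalent: (i) for every finite simple graph $G$, $\eta(G) \ge \chi(G)$; (ii) for every finite simple split graph $H$, $\eta(H^2) \ge \chi(H^2)$.
   Context: All graphs are finite, undirected and simple. $\chi(G)$ denotes the chromatic number of $G$. A graph $M$ is a minor of $G$ if a graph isomorphic to $M$ can be obtained from a subgraph of $G$ by contracting edges; the Hadwiger number $\eta(G)$ is the largest integer $t$ such that $G$ has a minor isomorphic to the complete graph $K_t$. A split graph is a graph whose vertex set can be partitioned into an independent set and a clique. The square $G^2$ of a graph $G$ is the graph on $V(G)$ in which two distinct vertices are adjacent if and only if their distance in $G$ is $1$ or $2$. (Statement (i) is Hadwiger's conjecture.) -}

module Defs where

open import Data.Nat using (ℕ; _≤_)
open import Data.Fin using (Fin; _≟_)
open import Data.Bool using (Bool; true; false; not; _∧_; _∨_)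
open import Data.Bool.Properties using (∧-comm)
open import Data.List using (List; []; _∷_; allFin)
open import Data.Bool.ListAction using (any)
open import Data.Maybe using (Maybe; just)
open import Data.Product using (Σ; ∃; _×_; _,_)
open import Relation.Nullary using (¬_; yes; no)
open import Relation.Nullary.Decidable using (⌊_⌋)
open import Relation.Binary.PropositionalEquality
  using (_≡_; _≢_; refl; cong; cong₂)

record Graph : Set where
  field
    n     : ℕ
    E     : Fin n → Fin n → Bool
    E-sym : ∀ u v → E u v ≡ E v u
    E-irr : ∀ v → E v v ≡ false

open Graph public

Adj : (G : Graph) → Fin (n G) → Fin (n G) → Set
Adj G u v = E G u v ≡ true

ProperColouring : (G : Graph) → (k : ℕ) → (Fin (n G) → Fin k) → Set
ProperColouring G k c = ∀ u v → Adj G u v → c u ≢ c v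

Colourable : Graph → ℕ → Set
Colourable G k = Σ (Fin (n G) → Fin k) (ProperColouring G k)

IsChromaticNumber : Graph → ℕ → Set
IsChromaticNumber G k = Colourable G k × (∀ k′ → Colourable G k′ → k ≤ k′)

data WalkIn (G : Graph) (P : Fin (n G) → Set) : Fin (n G) → Fin (n G) → Set where
  here : ∀ {u} → P u → WalkIn G P u u
  step : ∀ {u v w} → P u → Adj G u v → WalkIn G P v w → WalkIn G P u w

-- A K_t minor model: a map assigning to each vertex at most one branch
-- set (so branch sets are pairwise disjoint), such that each branch set is
-- nonempty and connected, and any two distinct branch sets are joined by an edge.
record KMinorModel (G : Graph) (t : ℕ) : Set where
  field
    branch    : Fin (n G) → Maybe (Fin t)
    nonempty  : ∀ i → ∃ λ v → branch v ≡ just i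
    connected : ∀ i u v → branch u ≡ just i → branch v ≡ just i →
                WalkIn G (λ w → branch w ≡ just i) u v
    touching  : ∀ i j → i ≢ j → ∃ λ u → ∃ λ v →
                branch u ≡ just i × branch v ≡ just j × Adj G u v

HasCompleteMinor : Graph → ℕ → Set
HasCompleteMinor G t = KMinorModel G t

IsHadwigerNumber : Graph → ℕ → Set
IsHadwigerNumber G t = HasCompleteMinor G t × (∀ t′ → HasCompleteMinor G t′ → t′ ≤ t)

HadwigerHolds : Graph → Set
HadwigerHolds G = ∀ η χ → IsHadwigerNumber G η → IsChromaticNumber G χ → χ ≤ η

-- Split graphs: V = I ⊎ K with I independent and K a clique.
-- part v ≡ true means v ∈ I, part v ≡ false means v ∈ K.

IsSplit : Graph → Set
IsSplit G = Σ (Fin (n G) → Bool) λ part →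
  (∀ u v → part u ≡ true → part v ≡ true → ¬ Adj G u v) ×
  (∀ u v → part u ≡ false → part v ≡ false → u ≢ v → Adj G u v)

private
  any-cong : ∀ {A : Set} (f g : A → Bool) → (∀ x → f x ≡ g x) →
             ∀ xs → any f xs ≡ any g xs
  any-cong f g eq []       = refl
  any-cong f g eq (x ∷ xs) = cong₂ _∨_ (eq x) (any-cong f g eq xs)

  ≟-sym : ∀ {m} (u v : Fin m) → ⌊ u ≟ v ⌋ ≡ ⌊ v ≟ u ⌋
  ≟-sym u v with u ≟ v | v ≟ u
  ... | yes _ | yes _ = refl
  ... | yes p | no ¬q = Relation.Nullary.contradiction (Relation.Binary.PropositionalEquality.sym p) ¬q
  ... | no ¬p | yes q = Relation.Nullary.contradiction (Relation.Binary.PropositionalEquality.sym q) ¬p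
  ... | no _  | no _  = refl

  ≟-refl : ∀ {m} (u : Fin m) → ⌊ u ≟ u ⌋ ≡ true
  ≟-refl u with u ≟ u
  ... | yes _ = refl
  ... | no ¬p = Relation.Nullary.contradiction refl ¬p

E² : (G : Graph) → Fin (n G) → Fin (n G) → Bool
E² G u v = not ⌊ u ≟ v ⌋ ∧ (E G u v ∨ any (λ w → E G u w ∧ E G w v) (allFin (n G)))

square : Graph → Graph
square G = record
  { n     = n G
  ; E     = E² G
  ; E-sym = λ u v → cong₂ (λ a b → not a ∧ b) (≟-sym u v)
              (cong₂ _∨_ (E-sym G u v)
                (any-cong _ _ (λ w → Relation.Binary.PropositionalEquality.trans
                   (cong₂ _∧_ (E-sym G u w) (E-sym G w v)) (∧-comm (E G w u) (E G v w)))
                   (allFin (n G))))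
  ; E-irr = λ v → cong (λ a → not a ∧ (E G v v ∨ any (λ w → E G v w ∧ E G w v) (allFin (n G)))) (≟-refl v)
  }

-- For G on n vertices let H be the split graph whose independent set is V(G) and whose
-- clique consists of all n² pairs (u, v), a vertex a being adjacent to (u, v) when
-- a ∈ {u, v} and u = v or uv ∈ E(G).  In H² two vertices of G are adjacent exactly when
-- they are adjacent in G (a common neighbour (u, v) of a ≠ b forces {a, b} = {u, v} to be
-- an edge), each a reaches every clique vertex through (a, a), and the clique stays a
-- clique: H² is the join of G with K_{n²}.  Joining K_N raises both χ and η by exactly N,
-- since the N clique vertices use N private colours and meet at most N branch sets of any
-- complete minor; so Hadwiger's inequality for H² yields it for G.

module Submission where

open import Defs
open import Data.Bool using (Bool; true; false; T)
import Data.Bool.Properties as Bool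
open import Data.Bool.Properties using (T-≡; T-∧; T-∨)
open import Data.Empty using (⊥; ⊥-elim)
open import Data.Fin as Fin
  using (Fin; zero; suc; _≟_; _↑ˡ_; _↑ʳ_; splitAt; remQuot; combine; punchIn; punchOut)
open import Data.Fin.Properties
  using (↑ˡ-injective; ↑ʳ-injective; splitAt-↑ˡ; splitAt-↑ʳ; splitAt⁻¹-↑ˡ; splitAt⁻¹-↑ʳ; join-splitAt;
         remQuot-combine; suc-injective; 0≢1+n; punchOut-injective; punchIn-injective; punchInᵢ≢i;
         punchIn-punchOut; punchOut-punchIn; punchOut-cong)
open import Data.List using (allFin)
open import Data.List.Membership.Propositional using (lose)
open import Data.List.Membership.Propositional.Properties using (∈-allFin)
open import Data.List.Relation.Unary.Any using (satisfied)
open import Data.List.Relation.Unary.Any.Properties using (any⁺; any⁻)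
open import Data.Maybe as Maybe using (Maybe; just; nothing)
open import Data.Maybe.Properties using (just-injective; map-just)
open import Data.Nat using (ℕ; zero; suc; _+_; _*_; _≤_; s≤s)
open import Data.Nat.Properties
  using (+-identityʳ; +-suc; ≤-refl; ≤-trans; ≤-reflexive; n≤1+n; +-monoˡ-≤; +-cancelʳ-≤)
open import Data.Product using (∃-syntax; _×_; _,_)
open import Data.Sum as Sum using (_⊎_; inj₁; inj₂; [_,_]′)
open import Function using (_∘_)
open import Function.Bundles using (_⇔_; mk⇔; Equivalence)
open Equivalence using (to; from)
open import Relation.Binary.Definitions using (Decidable; Symmetric)
open import Relation.Binary.PropositionalEquality
open import Relation.Nullary using (¬_; Dec; yes; no; does; contradiction)
open import Relation.Nullary.Decidable
  using (toWitnessFalse; fromWitnessFalse; dec-true; dec-false; does-⇔; _×-dec_; _⊎-dec_; ¬?)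

Adj-irrefl : ∀ (G : Graph) {x} → ¬ Adj G x x
Adj-irrefl G {x} xx with trans (sym (E-irr G x)) xx
... | ()

Adj-sym : ∀ (G : Graph) {x y} → Adj G x y → Adj G y x
Adj-sym G {x} {y} = trans (E-sym G y x)

mapWalk : ∀ {G J : Graph} {P : Fin (n G) → Set} {Q : Fin (n J) → Set} (f : Fin (n G) → Fin (n J)) →
          (∀ {a} → P a → Q (f a)) → (∀ {a b} → Adj G a b → Adj J (f a) (f b)) →
          ∀ {a b} → WalkIn G P a b → WalkIn J Q (f a) (f b)
mapWalk f P⇒Q adj (here pa)       = here (P⇒Q pa)
mapWalk f P⇒Q adj (step pa ab bc) = step (P⇒Q pa) (adj ab) (mapWalk f P⇒Q adj bc)

weakenWalk : ∀ {G : Graph} {P Q : Fin (n G) → Set} → (∀ {a} → P a → Q a) →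
             ∀ {a b} → WalkIn G P a b → WalkIn G Q a b
weakenWalk {G} P⇒Q = mapWalk {G} {G} (λ a → a) P⇒Q (λ ab → ab)

walk-head : ∀ {G : Graph} {P : Fin (n G) → Set} {a b} → WalkIn G P a b → P a
walk-head (here pa)     = pa
walk-head (step pa _ _) = pa

does-true⇒ : ∀ {A : Set} (a? : Dec A) → does a? ≡ true → A
does-true⇒ (yes a) _ = a

module FromRelation {m : ℕ} (R : Fin m → Fin m → Set) (R? : Decidable R)
         (R-sym : Symmetric R) (R-irr : ∀ x → ¬ R x x) where

  graph : Graph
  graph = record
    { n     = m
    ; E     = λ u v → does (R? u v)
    ; E-sym = λ u v → does-⇔ (mk⇔ R-sym R-sym) (R? u v) (R? v u)
    ; E-irr = λ v → dec-false (R? v v) (R-irr v)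
    }

  graph-adj⁺ : ∀ {u v} → R u v → Adj graph u v
  graph-adj⁺ {u} {v} = dec-true (R? u v)

  graph-adj⁻ : ∀ {u v} → Adj graph u v → R u v
  graph-adj⁻ {u} {v} = does-true⇒ (R? u v)

Dist≤2 : (G : Graph) → Fin (n G) → Fin (n G) → Set
Dist≤2 G u v = Adj G u v ⊎ ∃[ w ] Adj G u w × Adj G w v

module _ (G : Graph) {u v : Fin (n G)} where

  square-adj⁺ : u ≢ v → Dist≤2 G u v → Adj (square G) u v
  square-adj⁺ u≢v d = to T-≡ (from T-∧ (fromWitnessFalse u≢v , from T-∨ (Sum.map (from T-≡) viaMiddle d)))
    where
    viaMiddle : ∃[ w ] Adj G u w × Adj G w v → T _
    viaMiddle (w , uw , wv) = any⁺ _ (lose (∈-allFin w) (from T-∧ (from T-≡ uw , from T-≡ wv)))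

  square-adj⁻ : Adj (square G) u v → u ≢ v × Dist≤2 G u v
  square-adj⁻ uv with to T-∧ (from T-≡ uv)
  ... | u≢v , d = toWitnessFalse u≢v , Sum.map (to T-≡) viaMiddle (to T-∨ d)
    where
    viaMiddle : T _ → ∃[ w ] Adj G u w × Adj G w v
    viaMiddle t with satisfied (any⁻ _ (allFin (n G)) t)
    ... | w , uwv with to T-∧ uwv
    ... | uw , wv = w , to T-≡ uw , to T-≡ wv

↑ˡ≢↑ʳ : ∀ {m n} (a : Fin m) (p : Fin n) → a ↑ˡ n ≢ m ↑ʳ p
↑ˡ≢↑ʳ {m} {n} a p e with trans (sym (splitAt-↑ˡ m a n)) (trans (cong (splitAt m) e) (splitAt-↑ʳ m n p))
... | ()

↑-cover : ∀ m {n} (x : Fin (m + n)) → (∃[ a ] a ↑ˡ n ≡ x) ⊎ (∃[ p ] m ↑ʳ p ≡ x)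
↑-cover m x with splitAt m x in eq
... | inj₁ a = inj₁ (a , splitAt⁻¹-↑ˡ eq)
... | inj₂ p = inj₂ (p , splitAt⁻¹-↑ʳ eq)

splitAt-injective : ∀ m {n} {x y : Fin (m + n)} → splitAt m x ≡ splitAt m y → x ≡ y
splitAt-injective m {n} {x} {y} e =
  trans (sym (join-splitAt m n x)) (trans (cong (Fin.join m n) e) (join-splitAt m n y))

removeAvoidedColours : ∀ {G : Graph} j {k} (c : Fin (n G) → Fin k) → ProperColouring G k c →
                       (f : Fin j → Fin k) → (∀ {p q} → f p ≡ f q → p ≡ q) → (∀ a p → c a ≢ f p) →
                       ∃[ k′ ] k ≡ k′ + j × Colourable G k′
removeAvoidedColours zero {k} c proper _ _ _ = k , sym (+-identityʳ k) , c , proper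
removeAvoidedColours (suc j) {zero} _ _ f _ _ with f zero
... | ()
removeAvoidedColours {G} (suc j) {suc k} c proper f f-injective avoids =
  let (k′ , k≡k′+j , colourable) = removeAvoidedColours {G} j c′ proper′ f′ f′-injective avoids′
  in k′ , trans (cong suc k≡k′+j) (sym (+-suc k′ j)) , colourable
  where
  c′ : Fin (n G) → Fin k
  c′ a = punchOut {i = f zero} (avoids a zero ∘ sym)

  f′ : Fin j → Fin k
  f′ p = punchOut {i = f zero} (0≢1+n ∘ f-injective)

  proper′ : ProperColouring G k c′
  proper′ a b ab = proper a b ab ∘ punchOut-injective {i = f zero} _ _

  f′-injective : ∀ {p q} → f′ p ≡ f′ q → p ≡ q
  f′-injective = suc-injective ∘ f-injective ∘ punchOut-injective {i = f zero} _ _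

  avoids′ : ∀ a p → c′ a ≢ f′ p
  avoids′ a p = avoids a (suc p) ∘ punchOut-injective {i = f zero} _ _

-- A K_t model of G together with j extra vertices, each lying in at most one branch set
-- (apexBranch); only the branch sets containing no extra vertex are required to be
-- nonempty, connected and pairwise touching in G.
Avoids : ∀ {j t} → (Fin j → Maybe (Fin t)) → Fin t → Set
Avoids apex i = ∀ p → apex p ≢ just i

record ApexModel (G : Graph) (t j : ℕ) : Set where
  field
    branch     : Fin (n G) → Maybe (Fin t)
    apexBranch : Fin j → Maybe (Fin t)
    nonempty   : ∀ i → Avoids apexBranch i → ∃[ a ] branch a ≡ just i
    connected  : ∀ i → Avoids apexBranch i → ∀ a b → branch a ≡ just i → branch b ≡ just i →
                 WalkIn G (λ w → branch w ≡ just i) a b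
    touching   : ∀ i i′ → Avoids apexBranch i → Avoids apexBranch i′ → i ≢ i′ →
                 ∃[ a ] ∃[ b ] branch a ≡ just i × branch b ≡ just i′ × Adj G a b

module _ {t : ℕ} (i₀ : Fin (suc t)) where

  erase : Maybe (Fin (suc t)) → Maybe (Fin t)
  erase nothing = nothing
  erase (just i) with i₀ ≟ i
  ... | yes _    = nothing
  ... | no i₀≢i  = just (punchOut i₀≢i)

  erase⁻ : ∀ m {i} → erase m ≡ just i → m ≡ just (punchIn i₀ i)
  erase⁻ (just i) e with i₀ ≟ i
  erase⁻ (just i) refl | no i₀≢i = cong just (sym (punchIn-punchOut i₀≢i))

  erase⁺ : ∀ m {i} → m ≡ just (punchIn i₀ i) → erase m ≡ just i
  erase⁺ _ {i} refl with i₀ ≟ punchIn i₀ i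
  ... | yes i₀≡ = ⊥-elim (punchInᵢ≢i i₀ i (sym i₀≡))
  ... | no _    = cong just (trans (punchOut-cong i₀ refl) (punchOut-punchIn i₀))

dropApex : ∀ {G t j} → ApexModel G t (suc j) → ∃[ t′ ] t ≤ suc t′ × ApexModel G t′ j
dropApex M with ApexModel.apexBranch M zero in e₀
dropApex {G} {t} {j} M | nothing = t , n≤1+n t , record
  { branch     = branch
  ; apexBranch = apexBranch ∘ suc
  ; nonempty   = λ i → nonempty i ∘ avoids
  ; connected  = λ i → connected i ∘ avoids
  ; touching   = λ i i′ av av′ → touching i i′ (avoids av) (avoids av′)
  }
  where
  open ApexModel M
  avoids : ∀ {i} → Avoids (apexBranch ∘ suc) i → Avoids apexBranch i
  avoids _  zero e with trans (sym e₀) e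
  ... | ()
  avoids av (suc p) = av p
dropApex {t = zero} M | just ()
dropApex {G} {suc t} {j} M | just i₀ = t , ≤-refl , record
  { branch     = erase i₀ ∘ branch
  ; apexBranch = erase i₀ ∘ apexBranch ∘ suc
  ; nonempty   = λ i av →
      let (a , e) = nonempty (punchIn i₀ i) (avoids av) in a , erase⁺ i₀ (branch a) e
  ; connected  = λ i av a b ea eb →
      weakenWalk {G} (erase⁺ i₀ (branch _))
        (connected (punchIn i₀ i) (avoids av) a b (erase⁻ i₀ (branch a) ea) (erase⁻ i₀ (branch b) eb))
  ; touching   = λ i i′ av av′ i≢i′ →
      let (a , b , ea , eb , ab) = touching (punchIn i₀ i) (punchIn i₀ i′) (avoids av) (avoids av′)
                                            (i≢i′ ∘ punchIn-injective i₀ i i′)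
      in a , b , erase⁺ i₀ (branch a) ea , erase⁺ i₀ (branch b) eb , ab
  }
  where
  open ApexModel M
  avoids : ∀ {i} → Avoids (erase i₀ ∘ apexBranch ∘ suc) i → Avoids apexBranch (punchIn i₀ i)
  avoids {i} _  zero e = punchInᵢ≢i i₀ i (just-injective (trans (sym e) e₀))
  avoids     av (suc p) e = av p (erase⁺ i₀ (apexBranch (suc p)) e)

apexModel⇒model : ∀ {G t} j → ApexModel G t j → ∃[ t′ ] t ≤ t′ + j × KMinorModel G t′
apexModel⇒model {t = t} zero M = t , ≤-reflexive (sym (+-identityʳ t)) , record
  { branch    = branch
  ; nonempty  = λ i → nonempty i (λ ())
  ; connected = λ i → connected i (λ ())
  ; touching  = λ i i′ → touching i i′ (λ ()) (λ ())
  }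
  where open ApexModel M
apexModel⇒model (suc j) M =
  let (t′ , t≤1+t′ , M′) = dropApex M
      (t″ , t′≤t″+j , model) = apexModel⇒model j M′
  in t″ , ≤-trans t≤1+t′ (≤-trans (s≤s t′≤t″+j) (≤-reflexive (sym (+-suc t″ j)))) , model

record IsCliqueJoin (G J : Graph) (N : ℕ) : Set where
  field
    inl           : Fin (n G) → Fin (n J)
    inr           : Fin N → Fin (n J)
    inl-injective : ∀ {a b} → inl a ≡ inl b → a ≡ b
    cover         : ∀ x → (∃[ a ] inl a ≡ x) ⊎ (∃[ p ] inr p ≡ x)
    inl-adj⁺      : ∀ {a b} → Adj G a b → Adj J (inl a) (inl b)
    inl-adj⁻      : ∀ {a b} → Adj J (inl a) (inl b) → Adj G a b
    inl-inr-adj   : ∀ a p → Adj J (inl a) (inr p)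
    inr-adj       : ∀ {p q} → p ≢ q → Adj J (inr p) (inr q)

module CliqueJoin {G J : Graph} {N : ℕ} (join : IsCliqueJoin G J N) where
  open IsCliqueJoin join

  Side : Fin (n J) → Set
  Side x = (∃[ a ] inl a ≡ x) ⊎ (∃[ p ] inr p ≡ x)

  onSide : ∀ {A : Set} → (Fin (n G) → A) → (Fin N → A) → ∀ {x} → Side x → A
  onSide f g (inj₁ (a , _)) = f a
  onSide f g (inj₂ (p , _)) = g p

  inl≢inr : ∀ {a p} → inl a ≢ inr p
  inl≢inr {a} {p} e = Adj-irrefl J (subst (Adj J (inl a)) (sym e) (inl-inr-adj a p))

  inr-injective : ∀ {p q} → inr p ≡ inr q → p ≡ q
  inr-injective {p} {q} e with p ≟ q
  ... | yes p≡q = p≡q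
  ... | no  p≢q = ⊥-elim (Adj-irrefl J (subst (Adj J (inr p)) (sym e) (inr-adj p≢q)))

  onSide-inl : ∀ {A : Set} {f : Fin (n G) → A} {g : Fin N → A} {a} (s : Side (inl a)) → onSide f g s ≡ f a
  onSide-inl {f = f} (inj₁ (b , e)) = cong f (inl-injective e)
  onSide-inl (inj₂ (p , e))         = ⊥-elim (inl≢inr (sym e))

  onSide-inr : ∀ {A : Set} {f : Fin (n G) → A} {g : Fin N → A} {p} (s : Side (inr p)) → onSide f g s ≡ g p
  onSide-inr (inj₁ (a , e))         = ⊥-elim (inl≢inr e)
  onSide-inr {g = g} (inj₂ (q , e)) = cong g (inr-injective e)

  joinColourable : ∀ {k} → Colourable G k → Colourable J (k + N)
  joinColourable {k} (c , c-proper) = colour ∘ cover , λ u v → proper (cover u) (cover v)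
    where
    colour : ∀ {x} → Side x → Fin (k + N)
    colour = onSide (λ a → c a ↑ˡ N) (k ↑ʳ_)

    proper : ∀ {u v} (s : Side u) (t : Side v) → Adj J u v → colour s ≢ colour t
    proper (inj₁ (a , refl)) (inj₁ (b , refl)) ab = c-proper a b (inl-adj⁻ ab) ∘ ↑ˡ-injective N _ _
    proper (inj₁ (a , refl)) (inj₂ (q , refl)) _  = ↑ˡ≢↑ʳ _ q
    proper (inj₂ (p , refl)) (inj₁ (b , refl)) _  = ↑ˡ≢↑ʳ _ p ∘ sym
    proper (inj₂ (p , refl)) (inj₂ (q , refl)) pq e with ↑ʳ-injective k p q e
    ... | refl = Adj-irrefl J pq

  joinModel : ∀ {t} → KMinorModel G t → KMinorModel J (t + N)
  joinModel {t} model = record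
    { branch    = label ∘ cover
    ; nonempty  = nonempty′
    ; connected = λ i u v → connected′ (cover u) (cover v)
    ; touching  = touching′
    }
    where
    open KMinorModel model

    label : ∀ {x} → Side x → Maybe (Fin (t + N))
    label = onSide (Maybe.map (_↑ˡ N) ∘ branch) (λ p → just (t ↑ʳ p))

    label-inl : ∀ {a i} → branch a ≡ just i → label (cover (inl a)) ≡ just (i ↑ˡ N)
    label-inl e = trans (onSide-inl (cover _)) (map-just e)

    label-inr : ∀ p → label (cover (inr p)) ≡ just (t ↑ʳ p)
    label-inr p = onSide-inr (cover (inr p))

    label-inl⁻ : ∀ {a i} → Maybe.map (_↑ˡ N) (branch a) ≡ just i → ∃[ c ] branch a ≡ just c × c ↑ˡ N ≡ i
    label-inl⁻ {a} e with branch a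
    label-inl⁻ refl | just c = c , refl , refl

    nonempty′ : ∀ i → ∃[ x ] label (cover x) ≡ just i
    nonempty′ i with ↑-cover t i
    ... | inj₁ (c , refl) = let (a , e) = nonempty c in inl a , label-inl e
    ... | inj₂ (p , refl) = inr p , label-inr p

    connected′ : ∀ {i u v} (s : Side u) (s′ : Side v) → label s ≡ just i → label s′ ≡ just i →
                 WalkIn J (λ w → label (cover w) ≡ just i) u v
    connected′ (inj₁ (a , refl)) (inj₁ (b , refl)) ea eb with label-inl⁻ ea | label-inl⁻ eb
    ... | c , ca , refl | c′ , cb , c′≡c with ↑ˡ-injective N c′ c c′≡c
    ... | refl = mapWalk inl label-inl inl-adj⁺ (connected c a b ca cb)
    connected′ (inj₁ (a , refl)) (inj₂ (q , refl)) ea refl with label-inl⁻ ea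
    ... | c , _ , e = ⊥-elim (↑ˡ≢↑ʳ c q e)
    connected′ (inj₂ (p , refl)) (inj₁ (b , refl)) refl eb with label-inl⁻ eb
    ... | c , _ , e = ⊥-elim (↑ˡ≢↑ʳ c p e)
    connected′ (inj₂ (p , refl)) (inj₂ (q , refl)) refl e with ↑ʳ-injective t p q (just-injective (sym e))
    ... | refl = here (label-inr p)

    touching′ : ∀ i i′ → i ≢ i′ → ∃[ u ] ∃[ v ] label (cover u) ≡ just i × label (cover v) ≡ just i′ × Adj J u v
    touching′ i i′ i≢i′ with ↑-cover t i | ↑-cover t i′
    ... | inj₁ (c , refl) | inj₁ (c′ , refl) =
      let (a , b , ea , eb , ab) = touching c c′ (i≢i′ ∘ cong (_↑ˡ N))
      in inl a , inl b , label-inl ea , label-inl eb , inl-adj⁺ ab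
    ... | inj₁ (c , refl) | inj₂ (q , refl) =
      let (a , ea) = nonempty c in inl a , inr q , label-inl ea , label-inr q , inl-inr-adj a q
    ... | inj₂ (p , refl) | inj₁ (c , refl) =
      let (a , ea) = nonempty c in inr p , inl a , label-inr p , label-inl ea , Adj-sym J (inl-inr-adj a p)
    ... | inj₂ (p , refl) | inj₂ (q , refl) =
      inr p , inr q , label-inr p , label-inr q , inr-adj (i≢i′ ∘ cong (t ↑ʳ_))

  colourableOfJoin : ∀ {k} → Colourable J k → ∃[ k′ ] k ≡ k′ + N × Colourable G k′
  colourableOfJoin (c , proper) =
    removeAvoidedColours {G} N (c ∘ inl) (λ a b → proper _ _ ∘ inl-adj⁺) (c ∘ inr) injective
                         (λ a p → proper _ _ (inl-inr-adj a p))
    where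
    injective : ∀ {p q} → c (inr p) ≡ c (inr q) → p ≡ q
    injective {p} {q} e with p ≟ q
    ... | yes p≡q = p≡q
    ... | no  p≢q = contradiction e (proper _ _ (inr-adj p≢q))

  apexModelOfJoin : ∀ {t} → KMinorModel J t → ApexModel G t N
  apexModelOfJoin model = record
    { branch     = branch ∘ inl
    ; apexBranch = branch ∘ inr
    ; nonempty   = λ i av → let (x , e) = nonempty i in inlMember av (cover x) e
    ; connected  = λ i av a b ea eb → pullWalk av (connected i (inl a) (inl b) ea eb) refl refl
    ; touching   = λ i i′ av av′ i≢i′ →
        let (u , v , eu , ev , uv) = touching i i′ i≢i′ in touching′ av av′ (cover u) (cover v) eu ev uv
    }
    where
    open KMinorModel model

    inlMember : ∀ {i x} → Avoids (branch ∘ inr) i → Side x → branch x ≡ just i → ∃[ a ] branch (inl a) ≡ just i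
    inlMember _  (inj₁ (a , refl)) e = a , e
    inlMember av (inj₂ (p , refl)) e = ⊥-elim (av p e)

    pullWalk : ∀ {i x y a b} → Avoids (branch ∘ inr) i → WalkIn J (λ w → branch w ≡ just i) x y →
               inl a ≡ x → inl b ≡ y → WalkIn G (λ w → branch (inl w) ≡ just i) a b
    pullWalk _ (here px) refl e with inl-injective e
    ... | refl = here px
    pullWalk av (step {v = v} px xv vy) refl eb with cover v
    ... | inj₁ (c , refl) = step px (inl-adj⁻ xv) (pullWalk av vy refl eb)
    ... | inj₂ (q , refl) = ⊥-elim (av q (walk-head vy))

    touching′ : ∀ {i i′ u v} → Avoids (branch ∘ inr) i → Avoids (branch ∘ inr) i′ → Side u → Side v →
                branch u ≡ just i → branch v ≡ just i′ → Adj J u v →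
                ∃[ a ] ∃[ b ] branch (inl a) ≡ just i × branch (inl b) ≡ just i′ × Adj G a b
    touching′ _  _   (inj₁ (a , refl)) (inj₁ (b , refl)) ea eb ab = a , b , ea , eb , inl-adj⁻ ab
    touching′ av _   (inj₂ (p , refl)) _                 ep _  _  = ⊥-elim (av p ep)
    touching′ _  av′ (inj₁ _)          (inj₂ (q , refl)) _  eq _  = ⊥-elim (av′ q eq)

  joinChromatic : ∀ {χ} → IsChromaticNumber G χ → IsChromaticNumber J (χ + N)
  joinChromatic {χ} (colourable , least) = joinColourable colourable , least′
    where
    least′ : ∀ k → Colourable J k → χ + N ≤ k
    least′ k c with colourableOfJoin c
    ... | k′ , refl , c′ = +-monoˡ-≤ N (least k′ c′)

  joinHadwiger : ∀ {η} → IsHadwigerNumber G η → IsHadwigerNumber J (η + N)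
  joinHadwiger {η} (model , greatest) = joinModel model , greatest′
    where
    greatest′ : ∀ t → HasCompleteMinor J t → t ≤ η + N
    greatest′ t M with apexModel⇒model N (apexModelOfJoin M)
    ... | t′ , t≤t′+N , M′ = ≤-trans t≤t′+N (+-monoˡ-≤ N (greatest t′ M′))

  hadwiger-of-join : HadwigerHolds J → HadwigerHolds G
  hadwiger-of-join hadwigerJ η χ isη isχ =
    +-cancelʳ-≤ N χ η (hadwigerJ (η + N) (χ + N) (joinHadwiger isη) (joinChromatic isχ))

module SplitRoot (G : Graph) where

  N : ℕ
  N = n G * n G

  -- Pairs that are neither diagonal nor edges of G are incident to nothing: they only pad
  -- the clique to the convenient size n².
  Incident : Fin (n G) → Fin (n G) × Fin (n G) → Set
  Incident a (u , v) = (a ≡ u ⊎ a ≡ v) × (u ≡ v ⊎ Adj G u v)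

  incident? : ∀ a q → Dec (Incident a q)
  incident? a (u , v) = ((a ≟ u) ⊎-dec (a ≟ v)) ×-dec ((u ≟ v) ⊎-dec (E G u v Bool.≟ true))

  common-incident⇒adj : ∀ {a b q} → a ≢ b → Incident a q → Incident b q → Adj G a b
  common-incident⇒adj a≢b (inj₁ refl , _)         (inj₁ refl , _) = contradiction refl a≢b
  common-incident⇒adj a≢b (inj₂ refl , _)         (inj₂ refl , _) = contradiction refl a≢b
  common-incident⇒adj a≢b (inj₁ refl , inj₁ refl) (inj₂ refl , _) = contradiction refl a≢b
  common-incident⇒adj a≢b (inj₂ refl , inj₁ refl) (inj₁ refl , _) = contradiction refl a≢b
  common-incident⇒adj _   (inj₁ refl , inj₂ ab)   (inj₂ refl , _) = ab
  common-incident⇒adj _   (inj₂ refl , inj₂ ba)   (inj₁ refl , _) = Adj-sym G ba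

  RootAdj : Fin (n G) ⊎ Fin N → Fin (n G) ⊎ Fin N → Set
  RootAdj (inj₁ _) (inj₁ _) = ⊥
  RootAdj (inj₁ a) (inj₂ p) = Incident a (remQuot (n G) p)
  RootAdj (inj₂ p) (inj₁ a) = Incident a (remQuot (n G) p)
  RootAdj (inj₂ p) (inj₂ q) = p ≢ q

  rootAdj? : Decidable RootAdj
  rootAdj? (inj₁ _) (inj₁ _) = no λ ()
  rootAdj? (inj₁ a) (inj₂ p) = incident? a (remQuot (n G) p)
  rootAdj? (inj₂ p) (inj₁ a) = incident? a (remQuot (n G) p)
  rootAdj? (inj₂ p) (inj₂ q) = ¬? (p ≟ q)

  rootAdj-sym : Symmetric RootAdj
  rootAdj-sym {inj₁ _} {inj₂ _} i   = i
  rootAdj-sym {inj₂ _} {inj₁ _} i   = i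
  rootAdj-sym {inj₂ _} {inj₂ _} p≢q = p≢q ∘ sym

  rootAdj-irr : ∀ x → ¬ RootAdj x x
  rootAdj-irr (inj₂ p) p≢p = p≢p refl

  module Root = FromRelation (λ x y → RootAdj (splitAt (n G) x) (splitAt (n G) y))
                            (λ x y → rootAdj? (splitAt (n G) x) (splitAt (n G) y))
                            rootAdj-sym (rootAdj-irr ∘ splitAt (n G))

  root : Graph
  root = Root.graph

  root-split : IsSplit root
  root-split = inI ∘ splitAt (n G) , independent , clique
    where
    inI : Fin (n G) ⊎ Fin N → Bool
    inI = [ (λ _ → true) , (λ _ → false) ]′

    independent′ : ∀ s t → inI s ≡ true → inI t ≡ true → ¬ RootAdj s t
    independent′ (inj₁ _) (inj₁ _) _ _ ()

    clique′ : ∀ s t → inI s ≡ false → inI t ≡ false → s ≢ t → RootAdj s t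
    clique′ (inj₂ p) (inj₂ q) _ _ s≢t = s≢t ∘ cong inj₂

    independent : ∀ u v → inI (splitAt (n G) u) ≡ true → inI (splitAt (n G) v) ≡ true → ¬ Adj root u v
    independent u v iu iv = independent′ _ _ iu iv ∘ Root.graph-adj⁻

    clique : ∀ u v → inI (splitAt (n G) u) ≡ false → inI (splitAt (n G) v) ≡ false → u ≢ v → Adj root u v
    clique u v ku kv u≢v = Root.graph-adj⁺ (clique′ _ _ ku kv (u≢v ∘ splitAt-injective (n G)))

  inl : Fin (n G) → Fin (n root)
  inl a = a ↑ˡ N

  inr : Fin N → Fin (n root)
  inr p = n G ↑ʳ p

  root-adj⁺ : ∀ {x y s t} → splitAt (n G) x ≡ s → splitAt (n G) y ≡ t → RootAdj s t → Adj root x y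
  root-adj⁺ refl refl = Root.graph-adj⁺

  root-adj⁻ : ∀ {x y s t} → splitAt (n G) x ≡ s → splitAt (n G) y ≡ t → Adj root x y → RootAdj s t
  root-adj⁻ refl refl = Root.graph-adj⁻

  root-inl-inr⁺ : ∀ {a u v} → Incident a (u , v) → Adj root (inl a) (inr (combine u v))
  root-inl-inr⁺ {a} {u} {v} i =
    root-adj⁺ (splitAt-↑ˡ (n G) a N) (splitAt-↑ʳ (n G) N _) (subst (Incident a) (sym (remQuot-combine u v)) i)

  root-inr-inl⁺ : ∀ {a u v} → Incident a (u , v) → Adj root (inr (combine u v)) (inl a)
  root-inr-inl⁺ = Adj-sym root ∘ root-inl-inr⁺

  root-inr-inr⁺ : ∀ {p q} → p ≢ q → Adj root (inr p) (inr q)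
  root-inr-inr⁺ = root-adj⁺ (splitAt-↑ʳ (n G) N _) (splitAt-↑ʳ (n G) N _)

  squareOfRoot : IsCliqueJoin G (square root) N
  squareOfRoot = record
    { inl           = inl
    ; inr           = inr
    ; inl-injective = ↑ˡ-injective N _ _
    ; cover         = ↑-cover (n G)
    ; inl-adj⁺      = inl-adj⁺
    ; inl-adj⁻      = inl-adj⁻
    ; inl-inr-adj   = inl-inr-adj
    ; inr-adj       = λ p≢q → square-adj⁺ root (p≢q ∘ ↑ʳ-injective (n G) _ _) (inj₁ (root-inr-inr⁺ p≢q))
    }
    where
    inl-adj⁺ : ∀ {a b} → Adj G a b → Adj (square root) (inl a) (inl b)
    inl-adj⁺ ab = square-adj⁺ root (λ e → Adj-irrefl G (subst (Adj G _) (sym (↑ˡ-injective N _ _ e)) ab))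
      (inj₂ (_ , root-inl-inr⁺ (inj₁ refl , inj₂ ab) , root-inr-inl⁺ (inj₂ refl , inj₂ ab)))

    inl-adj⁻ : ∀ {a b} → Adj (square root) (inl a) (inl b) → Adj G a b
    inl-adj⁻ {a} {b} sq with square-adj⁻ root sq
    ... | _ , inj₁ ab = ⊥-elim (root-adj⁻ (splitAt-↑ˡ (n G) a N) (splitAt-↑ˡ (n G) b N) ab)
    ... | a≢b , inj₂ (w , aw , wb) with ↑-cover (n G) w
    ...   | inj₁ (c , refl) = ⊥-elim (root-adj⁻ (splitAt-↑ˡ (n G) a N) (splitAt-↑ˡ (n G) c N) aw)
    ...   | inj₂ (p , refl) = common-incident⇒adj (a≢b ∘ cong inl)
        (root-adj⁻ (splitAt-↑ˡ (n G) a N) (splitAt-↑ʳ (n G) N p) aw)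
        (root-adj⁻ (splitAt-↑ˡ (n G) b N) (splitAt-↑ʳ (n G) N p) (Adj-sym root wb))

    inl-inr-adj : ∀ a p → Adj (square root) (inl a) (inr p)
    inl-inr-adj a p = square-adj⁺ root (↑ˡ≢↑ʳ a p) viaDiagonal
      where
      viaDiagonal : Dist≤2 root (inl a) (inr p)
      viaDiagonal with combine a a ≟ p
      ... | yes refl = inj₁ (root-inl-inr⁺ (inj₁ refl , inj₁ refl))
      ... | no  aa≢p = inj₂ (_ , root-inl-inr⁺ (inj₁ refl , inj₁ refl) , root-inr-inr⁺ aa≢p)

theorem1 : (∀ (G : Graph) → HadwigerHolds G) ⇔
           (∀ (H : Graph) → IsSplit H → HadwigerHolds (square H))
theorem1 = mk⇔ (λ hadwiger H _ → hadwiger (square H)) fromSplitSquares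
  where
  fromSplitSquares : (∀ (H : Graph) → IsSplit H → HadwigerHolds (square H)) → ∀ G → HadwigerHolds G
  fromSplitSquares hadwiger G =
    CliqueJoin.hadwiger-of-join squareOfRoot (hadwiger root root-split)
    where open SplitRoot G
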